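{- Let $N=\{1,\dots,n\}$ and let $F:2^N\to\mathbb{R}$ be a quasi-submodular function given by a value oracle. The UQSFMax procedure applied to $F$ terminates in $\mathcal{O}(n)$ iterations, and its time complexity is $\mathcal{O}(n^2)$ (counting each oracle evaluation as unit cost).
   Context: For $A\subseteq N$ and $i\in N$, write $F(i\mid A)=F(A\cup\{i\})-F(A)$. A set function $F:2^N\to\mathbb{R}$ is quasi-submodular if for all $X,Y\subseteq N$ both (i) $F(X\cap Y)\ge F(X)\Rightarrow F(Y)\ge F(X\cup Y)$ and (ii) $F(X\cap Y)>F(X)\Rightarrow F(Y)>F(X\cup Y)$ hold. The UQSFMax procedure starts with $X_0=\emptyset$, $Y_0=N$ and runs for $t=0,1,2,\dots$: set $U_t=\{u\in Y_t\setminus X_t: F(u\mid Y_t\setminus\{u\})>0\}$ and $X_{t+1}=X_t\cup U_t$; set $D_t=\{d\in Y_t\setminus X_t: F(d\mid X_t)<0\}$ and $Y_{t+1}=Y_t\setminus D_t$; if $X_{t+1}=X_t$ and $Y_{t+1}=Y_t$, stop and output the lattice $[X_t,Y_t]=\{U:X_t\subseteq U\subseteq Y_t\}$; otherwise continue with $t+1$. -}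

module Defs where

open import Level using (Level; _⊔_)
open import Data.Bool using (Bool; true; false; if_then_else_; _∧_; not)
open import Data.Nat using (ℕ; zero; suc)
import Data.Nat as ℕ
open import Data.Fin using (Fin)
open import Data.Fin.Subset using (Subset; _∩_; _∪_; _─_; _-_; ⁅_⁆; ⊥; ⊤)
open import Data.Vec using (Vec; []; _∷_; lookup; tabulate)
import Data.Vec.Properties as VecP
import Data.Bool.Properties as BoolP
open import Data.Maybe using (Maybe; just; nothing)
open import Data.Product using (_×_; _,_)
open import Data.Sum using (_⊎_)
open import Relation.Nullary using (does)
open import Relation.Binary.Bundles using (StrictTotalOrder)

module _ {a ℓ₁ ℓ₂ : Level} (O : StrictTotalOrder a ℓ₁ ℓ₂) where
  open StrictTotalOrder O renaming (Carrier to R)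

  _≤R_ : R → R → Set (ℓ₁ ⊔ ℓ₂)
  x ≤R y = x < y ⊎ x ≈ y

  QuasiSubmodular : {n : ℕ} → (Subset n → R) → Set (ℓ₁ ⊔ ℓ₂)
  QuasiSubmodular {n} F =
    (X Y : Subset n) →
      ((F X ≤R F (X ∩ Y)) → (F (X ∪ Y) ≤R F Y)) ×
      ((F X < F (X ∩ Y)) → (F (X ∪ Y) < F Y))

-- A computation that counts oracle evaluations (writer monad over ℕ).
record Counted {c : Level} (A : Set c) : Set c where
  constructor _#_
  field
    value : A
    calls : ℕ
open Counted public

pureC : ∀ {c} {A : Set c} → A → Counted A
pureC x = x # 0

_>>=C_ : ∀ {c d} {A : Set c} {B : Set d} → Counted A → (A → Counted B) → Counted B
(x # k) >>=C f = value (f x) # (k ℕ.+ calls (f x))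

sequenceC : ∀ {c} {A : Set c} {m : ℕ} → Vec (Counted A) m → Counted (Vec A m)
sequenceC [] = pureC []
sequenceC (x ∷ xs) = x >>=C λ v → sequenceC xs >>=C λ vs → pureC (v ∷ vs)

State : ℕ → Set
State n = Subset n × Subset n

module UQSFMax {a ℓ₁ ℓ₂ : Level} (O : StrictTotalOrder a ℓ₁ ℓ₂)
               {n : ℕ} (F : Subset n → StrictTotalOrder.Carrier O) where
  open StrictTotalOrder O renaming (Carrier to R)

  query : Subset n → Counted R
  query S = F S # 1

  gainPos : Subset n → Fin n → Counted Bool
  gainPos A i = query A >>=C λ fA → query (A ∪ ⁅ i ⁆) >>=C λ fAi → pureC (does (fA <? fAi))

  gainNeg : Subset n → Fin n → Counted Bool
  gainNeg A i = query A >>=C λ fA → query (A ∪ ⁅ i ⁆) >>=C λ fAi → pureC (does (fAi <? fA))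

  inDiff : State n → Fin n → Bool
  inDiff (X , Y) i = lookup Y i ∧ not (lookup X i)

  Ustep : State n → Counted (Subset n)
  Ustep (X , Y) = sequenceC (tabulate λ u →
    if inDiff (X , Y) u then gainPos (Y - u) u else pureC false)

  Dstep : State n → Counted (Subset n)
  Dstep (X , Y) = sequenceC (tabulate λ d →
    if inDiff (X , Y) d then gainNeg X d else pureC false)

  eqSub : Subset n → Subset n → Bool
  eqSub A B = does (VecP.≡-dec BoolP._≟_ A B)

  iteration : State n → Counted (State n × Bool)
  iteration (X , Y) =
    Ustep (X , Y) >>=C λ U →
    Dstep (X , Y) >>=C λ D →
    pureC (((X ∪ U) , (Y ─ D)) , (eqSub (X ∪ U) X ∧ eqSub (Y ─ D) Y))

  -- run at most k iterations from state s; `just (X_t , Y_t)` (the output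
  -- lattice [X_t, Y_t]) iff the procedure stopped within k iterations
  run : ℕ → State n → Counted (Maybe (State n))
  run zero s = pureC nothing
  run (suc k) s = iteration s >>=C λ where
    (s' , true)  → pureC (just s)
    (s' , false) → run k s'

  initial : State n
  initial = ⊥ , ⊤

-- The potential is the number of undecided elements |Y_t ∖ X_t| ≤ n. Both U_t
-- and D_t are drawn from Y_t ∖ X_t, and the next undecided set is exactly
-- (Y_t ∖ X_t) ∖ (U_t ∪ D_t); so either U_t = D_t = ∅, in which case the state
-- is unchanged and the procedure stops, or the potential strictly drops. Hence
-- at most n + 1 iterations are run, each making at most 2n + 2n oracle calls.
module Submission where

open import Defs
open import Level using (Level)
open import Data.Nat using (ℕ; _≤_; _*_)
open import Data.Fin.Subset using (Subset)
open import Data.Maybe using (just)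
open import Data.Product using (∃; _×_; _,_)
open import Relation.Binary.PropositionalEquality using (_≡_)

open import Data.Bool using (Bool; true; false; _∧_; if_then_else_)
open import Data.Bool.Properties using (_≟_)
open import Data.Nat using (zero; suc; _+_; _<_; z≤n; s≤s; s≤s⁻¹)
open import Data.Nat.Properties
  using (≤-refl; ≤-trans; ≤-reflexive; <-≤-trans; +-mono-≤; +-monoˡ-≤; *-monoˡ-≤; +-identityʳ)
open import Data.Nat.Solver using (module +-*-Solver)
open import Data.Fin using (Fin)
import Data.Fin as Fin
open import Data.Fin.Subset using (_∈_; _∉_; _⊆_; _∪_; _─_; _-_; ⊥; ∣_∣)
open import Data.Fin.Subset.Properties
  using ( nonempty?; Empty-unique; x∈p∩q⁺; x∈p∪q⁻; p⊆p∪q; q⊆p∪q; x∈p∧x∉q⇒x∈p─q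
        ; p─⊥≡p; p─q─r≡p─q∪r; p∩q≢∅⇒∣p─q∣<∣p∣; ∪-comm; ∪-assoc; ∪-identityʳ; ∣p∣≤n)
open import Data.Vec using (_∷_; lookup; tabulate)
open import Data.Vec.Properties using (≡-dec; lookup∘tabulate; []=⇒lookup; lookup⇒[]=)
open import Data.Sum using (_⊎_; inj₁; inj₂; [_,_])
open import Function using (_∘_)
open import Relation.Nullary using (yes; no)
open import Relation.Nullary.Decidable using (dec-true)
open import Relation.Binary.Bundles using (StrictTotalOrder)
open import Relation.Binary.PropositionalEquality
  using (refl; sym; trans; cong; cong₂; subst; module ≡-Reasoning)

value-sequenceC-tabulate : ∀ {c} {A : Set c} {m} (g : Fin m → Counted A) →
  value (sequenceC (tabulate g)) ≡ tabulate (value ∘ g)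
value-sequenceC-tabulate {m = zero}  g = refl
value-sequenceC-tabulate {m = suc m} g =
  cong (value (g Fin.zero) ∷_) (value-sequenceC-tabulate (g ∘ Fin.suc))

calls-sequenceC-tabulate : ∀ {c} {A : Set c} {m} b (g : Fin m → Counted A) →
  (∀ i → calls (g i) ≤ b) → calls (sequenceC (tabulate g)) ≤ m * b
calls-sequenceC-tabulate {m = zero}  b g g≤b = z≤n
calls-sequenceC-tabulate {m = suc m} b g g≤b =
  +-mono-≤ (g≤b Fin.zero)
    (≤-trans (≤-reflexive (+-identityʳ _))
      (calls-sequenceC-tabulate b (g ∘ Fin.suc) (g≤b ∘ Fin.suc)))

∈-sequenceC-tabulate : ∀ {m} (g : Fin m → Counted Bool) {x} →
  x ∈ value (sequenceC (tabulate g)) → value (g x) ≡ true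
∈-sequenceC-tabulate g {x} x∈ = begin
  value (g x)                               ≡⟨ lookup∘tabulate (value ∘ g) x ⟨
  lookup (tabulate (value ∘ g)) x           ≡⟨ cong (λ v → lookup v x) (value-sequenceC-tabulate g) ⟨
  lookup (value (sequenceC (tabulate g))) x ≡⟨ []=⇒lookup x∈ ⟩
  true                                      ∎
  where open ≡-Reasoning

value-guard : ∀ b (c : Counted Bool) → value (if b then c else pureC false) ≡ true → b ≡ true
value-guard true  c _ = refl
value-guard false c ()

calls-guard : ∀ b (c : Counted Bool) → calls (if b then c else pureC false) ≤ calls c
calls-guard true  c = ≤-refl
calls-guard false c = z≤n

p─s─q∪r≡p─q─r∪s : ∀ {n} (p q r s : Subset n) → (p ─ s) ─ (q ∪ r) ≡ (p ─ q) ─ (r ∪ s)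
p─s─q∪r≡p─q─r∪s p q r s = begin
  (p ─ s) ─ (q ∪ r)   ≡⟨ p─q─r≡p─q∪r p s (q ∪ r) ⟩
  p ─ (s ∪ (q ∪ r))   ≡⟨ cong (p ─_) (trans (∪-comm s (q ∪ r)) (∪-assoc q r s)) ⟩
  p ─ (q ∪ (r ∪ s))   ≡⟨ p─q─r≡p─q∪r p q (r ∪ s) ⟨
  (p ─ q) ─ (r ∪ s)   ∎
  where open ≡-Reasoning

removal-empty-or-shrinks : ∀ {n} (X Y U D : Subset n) → U ⊆ Y ─ X → D ⊆ Y ─ X →
  (U ≡ ⊥ × D ≡ ⊥) ⊎ ∣ (Y ─ D) ─ (X ∪ U) ∣ < ∣ Y ─ X ∣
removal-empty-or-shrinks X Y U D U⊆ D⊆ with nonempty? (U ∪ D)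
... | yes (x , x∈U∪D) =
  inj₂ (subst (λ p → ∣ p ∣ < ∣ Y ─ X ∣) (sym (p─s─q∪r≡p─q─r∪s Y X U D))
    (p∩q≢∅⇒∣p─q∣<∣p∣ (Y ─ X) (U ∪ D)
      (x , x∈p∩q⁺ ([ U⊆ , D⊆ ] (x∈p∪q⁻ U D x∈U∪D) , x∈U∪D))))
... | no U∪D-empty =
  inj₁ ( Empty-unique (λ (x , x∈U) → U∪D-empty (x , p⊆p∪q D x∈U))
       , Empty-unique (λ (x , x∈D) → U∪D-empty (x , q⊆p∪q U D x∈D)))

undecided : ∀ {n} → State n → Subset n
undecided (X , Y) = Y ─ X

module _ {a ℓ₁ ℓ₂ : Level} (O : StrictTotalOrder a ℓ₁ ℓ₂)
         {n : ℕ} (F : Subset n → StrictTotalOrder.Carrier O) where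
  open UQSFMax O F

  inDiff⇒∈undecided : ∀ s x → inDiff s x ≡ true → x ∈ undecided s
  inDiff⇒∈undecided (X , Y) x inDiff≡true with lookup Y x in Yx | lookup X x in Xx
  ... | true | false = x∈p∧x∉q⇒x∈p─q (lookup⇒[]= x Y Yx) x∉X
    where
    x∉X : x ∉ X
    x∉X x∈X with trans (sym ([]=⇒lookup x∈X)) Xx
    ... | ()

  guarded⊆undecided : ∀ s (test : Fin n → Counted Bool) →
    value (sequenceC (tabulate λ i → if inDiff s i then test i else pureC false)) ⊆ undecided s
  guarded⊆undecided s test {x} x∈ =
    inDiff⇒∈undecided s x (value-guard (inDiff s x) (test x) (∈-sequenceC-tabulate _ x∈))

  calls-guarded : ∀ s (test : Fin n → Counted Bool) → (∀ i → calls (test i) ≤ 2) →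
    calls (sequenceC (tabulate λ i → if inDiff s i then test i else pureC false)) ≤ n * 2
  calls-guarded s test test≤2 =
    calls-sequenceC-tabulate 2 _ (λ i → ≤-trans (calls-guard (inDiff s i) (test i)) (test≤2 i))

  Ustep⊆undecided : ∀ s → value (Ustep s) ⊆ undecided s
  Ustep⊆undecided (X , Y) = guarded⊆undecided (X , Y) (λ u → gainPos (Y - u) u)

  Dstep⊆undecided : ∀ s → value (Dstep s) ⊆ undecided s
  Dstep⊆undecided (X , Y) = guarded⊆undecided (X , Y) (gainNeg X)

  iterationCost : ℕ
  iterationCost = n * 2 + n * 2

  calls-iteration : ∀ s → calls (iteration s) ≤ iterationCost
  calls-iteration (X , Y) =
    +-mono-≤ (calls-guarded (X , Y) (λ u → gainPos (Y - u) u) (λ _ → ≤-refl))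
      (≤-trans (≤-reflexive (+-identityʳ _))
        (calls-guarded (X , Y) (gainNeg X) (λ _ → ≤-refl)))

  iteration-stops-or-shrinks : ∀ s {s′ stop} → value (iteration s) ≡ (s′ , stop) →
    stop ≡ true ⊎ ∣ undecided s′ ∣ < ∣ undecided s ∣
  iteration-stops-or-shrinks (X , Y) refl
    with removal-empty-or-shrinks X Y _ _ (Ustep⊆undecided (X , Y)) (Dstep⊆undecided (X , Y))
  ... | inj₂ shrinks = inj₂ shrinks
  ... | inj₁ (U≡⊥ , D≡⊥) =
    inj₁ (cong₂ _∧_ (eqSub-true (trans (cong (X ∪_) U≡⊥) (∪-identityʳ X)))
                    (eqSub-true (trans (cong (Y ─_) D≡⊥) (p─⊥≡p Y))))
    where
    eqSub-true : ∀ {A B} → A ≡ B → eqSub A B ≡ true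
    eqSub-true {A} {B} = dec-true (≡-dec _≟_ A B)

  calls-run : ∀ k s → calls (run k s) ≤ k * iterationCost
  calls-run zero    s = z≤n
  calls-run (suc k) s with value (iteration s)
  ... | (s′ , true)  = +-mono-≤ (calls-iteration s) z≤n
  ... | (s′ , false) = +-mono-≤ (calls-iteration s) (calls-run k s′)

  run-stops : ∀ k s → ∣ undecided s ∣ < k → ∃ λ out → value (run k s) ≡ just out
  run-stops (suc k) s ∣s∣<1+k with value (iteration s) in step
  ... | (s′ , true)  = s , refl
  ... | (s′ , false) with iteration-stops-or-shrinks s step
  ...   | inj₂ shrinks = run-stops k s′ (<-≤-trans shrinks (s≤s⁻¹ ∣s∣<1+k))

1+n≤2*n : ∀ {n} → 1 ≤ n → suc n ≤ 2 * n
1+n≤2*n {n} 1≤n = ≤-trans (+-monoˡ-≤ n 1≤n) (≤-reflexive (cong (n +_) (sym (+-identityʳ n))))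

theorem3 : {a ℓ₁ ℓ₂ : Level} →
  ∃ λ (c : ℕ) → ∃ λ (n₀ : ℕ) →
    (n : ℕ) → n₀ ≤ n →
    (O : StrictTotalOrder a ℓ₁ ℓ₂) →
    (F : Subset n → StrictTotalOrder.Carrier O) →
    QuasiSubmodular O F →
    ∃ λ (k : ℕ) →
      (k ≤ c * n) ×
      (∃ λ (out : State n) → Counted.value (UQSFMax.run O F k (UQSFMax.initial O F)) ≡ just out) ×
      (Counted.calls (UQSFMax.run O F k (UQSFMax.initial O F)) ≤ c * (n * n))
theorem3 = 8 , 1 , λ n 1≤n O F _ →
  let s₀ = UQSFMax.initial O F in
    suc n
  , ≤-trans (1+n≤2*n 1≤n) (*-monoˡ-≤ n {2} {8} (s≤s (s≤s z≤n)))
  , run-stops O F (suc n) s₀ (s≤s (∣p∣≤n (undecided s₀)))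
  , ≤-trans (calls-run O F (suc n) s₀)
      (≤-trans (*-monoˡ-≤ (iterationCost O F) (1+n≤2*n 1≤n)) (≤-reflexive (2n*4n≡8n² n)))
  where
  open +-*-Solver
  2n*4n≡8n² : ∀ n → 2 * n * (n * 2 + n * 2) ≡ 8 * (n * n)
  2n*4n≡8n² = solve 1 (λ n → con 2 :* n :* (n :* con 2 :+ n :* con 2) := con 8 :* (n :* n)) refl
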